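{- Let $\Gamma$ be a finite simple connected graph with at least two vertices such that $\Gamma_2\cong\Gamma$, $\Gamma$ contains no subgraph isomorphic to $C_4$, and $\Gamma$ is not a cycle of odd length. If $\Gamma$ contains a $6$-cycle, then $\Gamma\cong C_5|C_3$.
   Context: For a finite simple graph $\Gamma$ with path-distance $d$, $\Gamma_2$ is the graph on $V(\Gamma)$ with $u,v$ adjacent iff $d(u,v)=2$. $C_5|C_3$ denotes the graph on six vertices $a,b,c,d,e,f$ with edges $ab,bc,cd,de,ef,fa,bf$. "Subgraph" means a not necessarily induced subgraph. -}

module Defs where

open import Data.Nat using (ℕ; zero; suc; _+_; _*_; _<_; _≤_)
open import Data.Nat.DivMod using (_%_)
open import Data.Fin using (Fin; toℕ; #_)
open import Data.Product using (Σ; _×_; _,_)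
open import Data.Sum using (_⊎_)
open import Data.Empty using (⊥)
open import Relation.Nullary using (¬_)
open import Relation.Binary.PropositionalEquality using (_≡_)
open import Relation.Binary.Definitions using (Decidable)
open import Function.Bundles using (_↔_; _⇔_; Inverse)
open import Function.Definitions using (Injective)

record Graph : Set₁ where
  field
    n      : ℕ
    Adj    : Fin n → Fin n → Set
    sym    : ∀ {u v} → Adj u v → Adj v u
    irrefl : ∀ {u} → ¬ Adj u u
    dec    : Decidable Adj
open Graph public

data Walk (G : Graph) : Fin (n G) → Fin (n G) → ℕ → Set where
  nil  : ∀ {u} → Walk G u u 0
  cons : ∀ {u w v k} → Adj G u w → Walk G w v k → Walk G u v (suc k)

Dist : (G : Graph) → Fin (n G) → Fin (n G) → ℕ → Set
Dist G u v k = Walk G u v k × (∀ m → m < k → ¬ Walk G u v m)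

Adj₂ : (G : Graph) → Fin (n G) → Fin (n G) → Set
Adj₂ G u v = Dist G u v 2

Connected : Graph → Set
Connected G = ∀ u v → Σ ℕ λ k → Walk G u v k

Iso : ∀ {a b} → (Fin a → Fin a → Set) → (Fin b → Fin b → Set) → Set
Iso {a} {b} R S =
  Σ (Fin a ↔ Fin b) λ f → ∀ u v → R u v ⇔ S (Inverse.to f u) (Inverse.to f v)

SubgraphOf : ∀ {a b} → (Fin a → Fin a → Set) → (Fin b → Fin b → Set) → Set
SubgraphOf {a} {b} H R =
  Σ (Fin a → Fin b) λ f → Injective _≡_ _≡_ f × (∀ u v → H u v → R (f u) (f v))

CycleAdj : (k : ℕ) → Fin (3 + k) → Fin (3 + k) → Set
CycleAdj k i j = (toℕ j ≡ suc (toℕ i) % (3 + k)) ⊎ (toℕ i ≡ suc (toℕ j) % (3 + k))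

C₄ : Fin 4 → Fin 4 → Set
C₄ = CycleAdj 1

C₆ : Fin 6 → Fin 6 → Set
C₆ = CycleAdj 3

data C53Edge : Fin 6 → Fin 6 → Set where
  ab : C53Edge (# 0) (# 1)
  bc : C53Edge (# 1) (# 2)
  cd : C53Edge (# 2) (# 3)
  de : C53Edge (# 3) (# 4)
  ef : C53Edge (# 4) (# 5)
  fa : C53Edge (# 5) (# 0)
  bf : C53Edge (# 1) (# 5)

C5|C3 : Fin 6 → Fin 6 → Set
C5|C3 i j = C53Edge i j ⊎ C53Edge j i

-- Γ is a cycle of odd length: Γ ≅ C_{2m+3} for some m.
IsOddCycle : Graph → Set
IsOddCycle G = Σ ℕ λ m → Iso (Adj G) (CycleAdj (2 * m))

module Submission where

-- Let Γ be connected and C₄-free with Γ₂ ≅ Γ via φ, and let c₀ … c₅ be a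
-- 6-cycle ("hexagon") in Γ.  Because φ maps Γ₂-edges to Γ-edges injectively,
-- every forbidden configuration of Γ is also forbidden in Γ₂; we use three:
-- 4-cycles, vertices of degree four, and a vertex adjacent to two vertices on
-- disjoint triangles.  Degree four is excluded in Γ because four neighbours of
-- a vertex, whose neighbourhood is a matching, always contain a Γ₂-4-cycle;
-- the triangle pattern is excluded because it gives a vertex of Γ₂-degree four.
--
-- A hexagon has no opposite chords (they close 4-cycles).  If it has a short
-- chord c_{i}c_{i+2}, rotate it to c₅c₁: the other diagonals are non-edges, no
-- outside vertex can touch a corner, so by connectivity Γ is the hexagon plus
-- the chord, i.e. C5|C3.  If it has no short chord, again no outside vertex
-- touches a corner, so Γ is an induced hexagon; but then c₀c₂c₄ is a triangle
-- of Γ₂, whose image under φ is a triangle in the bipartite graph C₆.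

open import Defs
open import Data.Nat using (ℕ; zero; suc; _+_; _<_; _≤_; _≡ᵇ_; z≤n; s≤s)
open import Data.Nat.DivMod using (_%_; m%n<n)
open import Data.Fin using (Fin; zero; suc; toℕ; fromℕ<; _≟_)
open import Data.Fin.Patterns using (0F; 1F; 2F; 3F; 4F; 5F)
open import Data.Fin.Properties using (toℕ-fromℕ<; toℕ-injective; all?; any?)
open import Data.Bool using (Bool; true; false)
open import Data.List using (List; []; _∷_; map; lookup)
open import Data.List.Membership.Propositional.Properties using (∈-lookup)
import Data.List.Relation.Unary.All as All
open All using ([]; _∷_)
open import Data.List.Relation.Unary.AllPairs using ([]; _∷_)
open import Data.List.Relation.Unary.Unique.Propositional using (Unique)
open import Data.List.Relation.Unary.Unique.Propositional.Properties using (map⁺)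
import Data.List.Relation.Unary.Unique.DecPropositional as DecUnique
open import Data.Product using (Σ; ∃; _×_; _,_; proj₁; proj₂)
open import Data.Sum using (_⊎_; inj₁; inj₂; swap)
open import Data.Empty using (⊥; ⊥-elim)
open import Relation.Nullary using (¬_; Dec; yes; no)
open import Relation.Nullary.Decidable
  using (True; False; toWitness; toWitnessFalse; map′; _⊎-dec_; _→-dec_)
open import Relation.Binary.Definitions using (DecidableEquality)
open import Relation.Binary.PropositionalEquality
  using (_≡_; _≢_; refl; trans; cong; subst₂; ≢-sym) renaming (sym to ≡-sym)
open import Function.Bundles using (_↔_; _⇔_; Inverse; Equivalence; Injection; mk↔ₛ′; mk⇔)
open import Function.Definitions using (Injective)
open import Function.Properties.Inverse using (↔⇒↣)

next : ∀ {k} → Fin (3 + k) → Fin (3 + k)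
next {k} i = fromℕ< (m%n<n (suc (toℕ i)) (3 + k))

next-adjacent : ∀ {k} (i : Fin (3 + k)) → CycleAdj k i (next i)
next-adjacent {k} i = inj₁ (toℕ-fromℕ< (m%n<n (suc (toℕ i)) (3 + k)))

adjacent-next : ∀ {k} {i j : Fin (3 + k)} → CycleAdj k i j → j ≡ next i ⊎ i ≡ next j
adjacent-next (inj₁ p) = inj₁ (toℕ-injective (trans p (≡-sym (toℕ-fromℕ< _))))
adjacent-next (inj₂ p) = inj₂ (toℕ-injective (trans p (≡-sym (toℕ-fromℕ< _))))

cycle-subgraph : ∀ {k m} {R : Fin m → Fin m → Set} → (∀ {x y} → R x y → R y x) →
                 (c : Fin (3 + k) → Fin m) → Injective _≡_ _≡_ c →
                 (∀ i → R (c i) (c (next i))) → SubgraphOf (CycleAdj k) R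
cycle-subgraph {k} {R = R} R-sym c c-injective around = c , c-injective , edge
  where
  edge : ∀ i j → CycleAdj k i j → R (c i) (c j)
  edge i j adj with adjacent-next adj
  ... | inj₁ refl = around i
  ... | inj₂ refl = R-sym (around j)

next-injective : Injective _≡_ _≡_ (next {3})
next-injective {i} {j} =
  toWitness {a? = all? λ i → all? λ j → (next i ≟ next j) →-dec (i ≟ j)} _ i j

four-consecutive : ∀ (i : Fin 6) → Unique (i ∷ next i ∷ next (next i) ∷ next (next (next i)) ∷ [])
four-consecutive =
  toWitness {a? = all? λ i → unique? (i ∷ next i ∷ next (next i) ∷ next (next (next i)) ∷ [])} _
  where open DecUnique _≟_ using (unique?)

data Offset : Fin 6 → Fin 6 → Set where
  same      : ∀ i → Offset i i
  step      : ∀ i → Offset i (next i)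
  back      : ∀ i → Offset (next i) i
  skip      : ∀ i → Offset i (next (next i))
  skip-back : ∀ i → Offset (next (next i)) i
  opposite  : ∀ i → Offset i (next (next (next i)))

relative-position : ∀ (i j : Fin 6) →
  j ≡ i ⊎ j ≡ next i ⊎ i ≡ next j ⊎ j ≡ next (next i) ⊎ i ≡ next (next j) ⊎ j ≡ next (next (next i))
relative-position = toWitness {a? = all? λ i → all? λ j →
  (j ≟ i) ⊎-dec (j ≟ next i) ⊎-dec (i ≟ next j) ⊎-dec
  (j ≟ next (next i)) ⊎-dec (i ≟ next (next j)) ⊎-dec (j ≟ next (next (next i)))} _

offset : ∀ i j → Offset i j
offset i j with relative-position i j
... | inj₁ refl                                = same i
... | inj₂ (inj₁ refl)                         = step i
... | inj₂ (inj₂ (inj₁ refl))                  = back j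
... | inj₂ (inj₂ (inj₂ (inj₁ refl)))           = skip i
... | inj₂ (inj₂ (inj₂ (inj₂ (inj₁ refl))))    = skip-back j
... | inj₂ (inj₂ (inj₂ (inj₂ (inj₂ refl))))    = opposite i

parity : Fin 6 → Bool
parity i = toℕ i % 2 ≡ᵇ 0

parity-alternates : ∀ i → parity i ≢ parity (next i)
parity-alternates 0F ()
parity-alternates 1F ()
parity-alternates 2F ()
parity-alternates 3F ()
parity-alternates 4F ()
parity-alternates 5F ()

three-bools : ∀ (a b c : Bool) → a ≢ b → b ≢ c → c ≢ a → ⊥
three-bools false false _     a≢b _   _   = a≢b refl
three-bools true  true  _     a≢b _   _   = a≢b refl
three-bools false true  false _   _   c≢a = c≢a refl
three-bools false true  true  _   b≢c _   = b≢c refl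
three-bools true  false false _   b≢c _   = b≢c refl
three-bools true  false true  _   _   c≢a = c≢a refl

lookup-injective : ∀ {A : Set} {xs : List A} → Unique xs → Injective _≡_ _≡_ (lookup xs)
lookup-injective (_ ∷ _)    {zero}  {zero}  _  = refl
lookup-injective (x∉ ∷ _)   {zero}  {suc j} eq = ⊥-elim (All.lookup x∉ (∈-lookup j) eq)
lookup-injective (x∉ ∷ _)   {suc i} {zero}  eq = ⊥-elim (All.lookup x∉ (∈-lookup i) (≡-sym eq))
lookup-injective (_ ∷ uniq) {suc i} {suc j} eq = cong suc (lookup-injective uniq eq)

module Labelled {P A : Set} (_≟ₚ_ : DecidableEquality P)
                (label : P → A) (label-injective : Injective _≡_ _≡_ label) where
  open DecUnique _≟ₚ_ public using (unique?)

  distinct : (ps : List P) {_ : True (unique? ps)} → Unique (map label ps)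
  distinct ps {ok} = map⁺ label-injective (toWitness ok)

  apart : (p q : P) {_ : False (p ≟ₚ q)} → label p ≢ label q
  apart p q {p≢q} eq = toWitnessFalse p≢q (label-injective eq)

data Point : Set where
  ⟨_⟩ : Fin 6 → Point
  ∗   : Point

_≟ₚ_ : DecidableEquality Point
⟨ i ⟩ ≟ₚ ⟨ j ⟩ = map′ (cong ⟨_⟩) (λ { refl → refl }) (i ≟ j)
⟨ _ ⟩ ≟ₚ ∗     = no λ ()
∗     ≟ₚ ⟨ _ ⟩ = no λ ()
∗     ≟ₚ ∗     = yes refl

module Setting (Γ : Graph) (C₄-free : ¬ SubgraphOf C₄ (Adj Γ))
               (Γ₂≅Γ : Iso (Adj₂ Γ) (Adj Γ)) where

  V : Set
  V = Fin (n Γ)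

  infix 4 _~_ _~₂_
  _~_ _~₂_ : V → V → Set
  _~_  = Adj Γ
  _~₂_ = Adj₂ Γ

  ~-sym : ∀ {a b} → a ~ b → b ~ a
  ~-sym = sym Γ

  ≁-sym : ∀ {a b} → ¬ a ~ b → ¬ b ~ a
  ≁-sym a≁b b~a = a≁b (~-sym b~a)

  adjacent⇒distinct : ∀ {a b} → a ~ b → a ≢ b
  adjacent⇒distinct a~a refl = irrefl Γ a~a

  dist2 : ∀ {a m b} → a ≢ b → ¬ a ~ b → a ~ m → m ~ b → a ~₂ b
  dist2 {a} {m} {b} a≢b a≁b a~m m~b = cons a~m (cons m~b nil) , no-shorter
    where
    no-shorter : ∀ l → l < 2 → ¬ Walk Γ a b l
    no-shorter 0 _ nil = a≢b refl
    no-shorter 1 _ (cons a~b nil) = a≁b a~b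
    no-shorter (suc (suc _)) (s≤s (s≤s ())) _

  ~₂-sym : ∀ {a b} → a ~₂ b → b ~₂ a
  ~₂-sym (cons a~m (cons m~b nil) , no-shorter) =
    dist2 (λ { refl → no-shorter 0 (s≤s z≤n) nil })
          (λ b~a → no-shorter 1 (s≤s (s≤s z≤n)) (cons (~-sym b~a) nil))
          (~-sym m~b) (~-sym a~m)

  φ : V → V
  φ = Inverse.to (proj₁ Γ₂≅Γ)

  φ-hom : ∀ {a b} → a ~₂ b → φ a ~ φ b
  φ-hom {a} {b} = Equivalence.to (proj₂ Γ₂≅Γ a b)

  φ-injective : Injective _≡_ _≡_ φ
  φ-injective = Injection.injective (↔⇒↣ (proj₁ Γ₂≅Γ))

  square : ∀ {a b c d} → Unique (a ∷ b ∷ c ∷ d ∷ []) → a ~ b → b ~ c → c ~ d → d ~ a → ⊥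
  square {a} {b} {c} {d} abcd a~b b~c c~d d~a =
    C₄-free (cycle-subgraph {R = _~_} ~-sym (lookup (a ∷ b ∷ c ∷ d ∷ [])) (lookup-injective abcd) around)
    where
    around : ∀ i → lookup (a ∷ b ∷ c ∷ d ∷ []) i ~ lookup (a ∷ b ∷ c ∷ d ∷ []) (next i)
    around 0F = a~b
    around 1F = b~c
    around 2F = c~d
    around 3F = d~a

  square₂ : ∀ {a b c d} → Unique (a ∷ b ∷ c ∷ d ∷ []) → a ~₂ b → b ~₂ c → c ~₂ d → d ~₂ a → ⊥
  square₂ abcd a~b b~c c~d d~a =
    square (map⁺ φ-injective abcd) (φ-hom a~b) (φ-hom b~c) (φ-hom c~d) (φ-hom d~a)

  -- Each neighbour of v is adjacent to at most one other (else a
  -- 4-cycle through v), so four non-adjacent pairs among them close a 4-cycle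
  -- of Γ₂; which four depends on where the (at most two) edges lie.
  subcubic : ∀ {v a b c d} → Unique (a ∷ b ∷ c ∷ d ∷ []) →
             v ~ a → v ~ b → v ~ c → v ~ d → ⊥
  subcubic {v} {a} {b} {c} {d} abcd v~a v~b v~c v~d = cases
    where
    nb : Fin 4 → V
    nb = lookup (a ∷ b ∷ c ∷ d ∷ [])
    open Labelled _≟_ nb (lookup-injective abcd) using (unique?; distinct)

    spoke : ∀ i → v ~ nb i
    spoke 0F = v~a
    spoke 1F = v~b
    spoke 2F = v~c
    spoke 3F = v~d

    monogamous : ∀ i j k {_ : True (unique? (j ∷ i ∷ k ∷ []))} → nb i ~ nb j → ¬ nb i ~ nb k
    monogamous i j k {jik} i~j i~k =
      square ((adjacent⇒distinct (spoke j) ∷ adjacent⇒distinct (spoke i) ∷ adjacent⇒distinct (spoke k) ∷ [])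
               ∷ distinct (j ∷ i ∷ k ∷ []) {jik})
             (spoke j) (~-sym i~j) i~k (~-sym (spoke k))

    far : ∀ i j → nb i ≢ nb j → ¬ nb i ~ nb j → nb i ~₂ nb j
    far i j i≢j i≁j = dist2 i≢j i≁j (~-sym (spoke i)) (spoke j)

    antisquare : ∀ i j k l {_ : True (unique? (i ∷ j ∷ k ∷ l ∷ []))} →
                 ¬ nb i ~ nb j → ¬ nb j ~ nb k → ¬ nb k ~ nb l → ¬ nb l ~ nb i → ⊥
    antisquare i j k l {ijkl} i≁j j≁k k≁l l≁i
      with distinct (i ∷ j ∷ k ∷ l ∷ []) {ijkl}
    ... | uniq@((i≢j ∷ _ ∷ i≢l ∷ []) ∷ (j≢k ∷ _ ∷ []) ∷ (k≢l ∷ []) ∷ [] ∷ []) =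
      square₂ uniq (far i j i≢j i≁j) (far j k j≢k j≁k) (far k l k≢l k≁l) (far l i (≢-sym i≢l) l≁i)

    cases : ⊥
    cases with dec Γ a b | dec Γ a c | dec Γ a d | dec Γ b c | dec Γ b d
    ... | yes a~b | _ | _ | _ | _ =
      antisquare 0F 2F 1F 3F (monogamous 0F 1F 2F a~b) (≁-sym (monogamous 1F 0F 2F (~-sym a~b)))
                             (monogamous 1F 0F 3F (~-sym a~b)) (≁-sym (monogamous 0F 1F 3F a~b))
    ... | no a≁b | yes a~c | _ | _ | _ =
      antisquare 0F 1F 2F 3F a≁b (≁-sym (monogamous 2F 0F 1F (~-sym a~c)))
                             (monogamous 2F 0F 3F (~-sym a~c)) (≁-sym (monogamous 0F 2F 3F a~c))
    ... | no a≁b | no a≁c | yes a~d | _ | _ =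
      antisquare 0F 1F 3F 2F a≁b (≁-sym (monogamous 3F 0F 1F (~-sym a~d)))
                             (monogamous 3F 0F 2F (~-sym a~d)) (≁-sym a≁c)
    ... | no a≁b | no a≁c | no _ | yes b~c | _ =
      antisquare 0F 1F 3F 2F a≁b (monogamous 1F 2F 3F b~c)
                             (≁-sym (monogamous 2F 1F 3F (~-sym b~c))) (≁-sym a≁c)
    ... | no a≁b | no _ | no a≁d | no _ | yes b~d =
      antisquare 0F 1F 2F 3F a≁b (monogamous 1F 3F 2F b~d)
                             (≁-sym (monogamous 3F 1F 2F (~-sym b~d))) (≁-sym a≁d)
    ... | no _ | no a≁c | no a≁d | no b≁c | no b≁d =
      antisquare 0F 2F 1F 3F a≁c (≁-sym b≁c) b≁d (≁-sym a≁d)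

  subcubic₂ : ∀ {v a b c d} → Unique (a ∷ b ∷ c ∷ d ∷ []) →
              v ~₂ a → v ~₂ b → v ~₂ c → v ~₂ d → ⊥
  subcubic₂ abcd v~a v~b v~c v~d =
    subcubic (map⁺ φ-injective abcd) (φ-hom v~a) (φ-hom v~b) (φ-hom v~c) (φ-hom v~d)

  -- A vertex adjacent to a corner p of a triangle p t t', and distinct from t
  -- and t', is at distance two from t (adjacency would close a 4-cycle).
  beside-triangle : ∀ {y p t t'} → y ≢ t → y ≢ t' → y ~ p → p ~ t → p ~ t' → t ~ t' → y ~₂ t
  beside-triangle y≢t y≢t' y~p p~t p~t' t~t' =
    dist2 y≢t (λ y~t → square ytt'p y~t t~t' (~-sym p~t') (~-sym y~p)) y~p p~t
    where
    ytt'p = (y≢t ∷ y≢t' ∷ adjacent⇒distinct y~p ∷ [])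
          ∷ (adjacent⇒distinct t~t' ∷ adjacent⇒distinct (~-sym p~t) ∷ [])
          ∷ (adjacent⇒distinct (~-sym p~t') ∷ []) ∷ [] ∷ []

  -- Forbidden configuration 3, in Γ and hence in Γ₂: a vertex y adjacent to
  -- corners p, q of triangles p p₁ p₂ and q q₁ q₂, with y, p₁, p₂, q₁, q₂
  -- distinct; y would be at distance two from p₁, p₂, q₁, q₂.
  two-triangles : ∀ {y p p₁ p₂ q q₁ q₂} → Unique (y ∷ p₁ ∷ p₂ ∷ q₁ ∷ q₂ ∷ []) →
                  y ~ p → y ~ q → p ~ p₁ → p ~ p₂ → p₁ ~ p₂ → q ~ q₁ → q ~ q₂ → q₁ ~ q₂ → ⊥
  two-triangles ((y≢p₁ ∷ y≢p₂ ∷ y≢q₁ ∷ y≢q₂ ∷ []) ∷ p₁p₂q₁q₂)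
                y~p y~q p~p₁ p~p₂ p₁~p₂ q~q₁ q~q₂ q₁~q₂ =
    subcubic₂ p₁p₂q₁q₂
      (beside-triangle y≢p₁ y≢p₂ y~p p~p₁ p~p₂ p₁~p₂)
      (beside-triangle y≢p₂ y≢p₁ y~p p~p₂ p~p₁ (~-sym p₁~p₂))
      (beside-triangle y≢q₁ y≢q₂ y~q q~q₁ q~q₂ q₁~q₂)
      (beside-triangle y≢q₂ y≢q₁ y~q q~q₂ q~q₁ (~-sym q₁~q₂))

  two-triangles₂ : ∀ {y p p₁ p₂ q q₁ q₂} → Unique (y ∷ p₁ ∷ p₂ ∷ q₁ ∷ q₂ ∷ []) →
                   y ~₂ p → y ~₂ q → p ~₂ p₁ → p ~₂ p₂ → p₁ ~₂ p₂ → q ~₂ q₁ → q ~₂ q₂ → q₁ ~₂ q₂ → ⊥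
  two-triangles₂ uniq y~p y~q p~p₁ p~p₂ p₁~p₂ q~q₁ q~q₂ q₁~q₂ =
    two-triangles (map⁺ φ-injective uniq) (φ-hom y~p) (φ-hom y~q)
      (φ-hom p~p₁) (φ-hom p~p₂) (φ-hom p₁~p₂) (φ-hom q~q₁) (φ-hom q~q₂) (φ-hom q₁~q₂)

  record Hexagon : Set where
    field
      corner           : Fin 6 → V
      corner-injective : Injective _≡_ _≡_ corner
      side             : ∀ i → corner i ~ corner (next i)

    side⁻ : ∀ i → corner (next i) ~ corner i
    side⁻ i = ~-sym (side i)

  hexagon : SubgraphOf C₆ (Adj Γ) → Hexagon
  hexagon (c , c-injective , c-hom) = record
    { corner = c ; corner-injective = c-injective ; side = λ i → c-hom i (next i) (next-adjacent i) }

  module _ (h : Hexagon) where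
    open Hexagon h

    rotate : Hexagon
    rotate = record
      { corner = λ i → corner (next i)
      ; corner-injective = λ eq → next-injective (corner-injective eq)
      ; side = λ i → side (next i)
      }

    -- Opposite corners are not adjacent: that would close a 4-cycle.
    opposite-free : ∀ i → ¬ corner i ~ corner (next (next (next i)))
    opposite-free i e =
      square (map⁺ corner-injective (four-consecutive i))
             (side i) (side (next i)) (side (next (next i))) (~-sym e)

    diagonal₂ : ∀ i → ¬ corner i ~ corner (next (next i)) → corner i ~₂ corner (next (next i))
    diagonal₂ i i≁i+2 with map⁺ corner-injective (four-consecutive i)
    ... | (_ ∷ i≢i+2 ∷ _ ∷ []) ∷ _ = dist2 i≢i+2 i≁i+2 (side i) (side (next i))

  turn : ℕ → Hexagon → Hexagon
  turn zero    h = h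
  turn (suc k) h = rotate (turn k h)

  module WithOutsider (h : Hexagon) (x : V) (outside : ∀ j → x ≢ Hexagon.corner h j) where
    open Hexagon h

    point : Point → V
    point ⟨ i ⟩ = corner i
    point ∗     = x

    point-injective : Injective _≡_ _≡_ point
    point-injective {⟨ i ⟩} {⟨ j ⟩} eq = cong ⟨_⟩ (corner-injective eq)
    point-injective {⟨ i ⟩} {∗}     eq = ⊥-elim (outside i (≡-sym eq))
    point-injective {∗}     {⟨ j ⟩} eq = ⊥-elim (outside j eq)
    point-injective {∗}     {∗}     _  = refl

    open Labelled _≟ₚ_ point point-injective public using (distinct; apart)

  exhaustive : Connected Γ → ∀ {k} (c : Fin k → V) →
               (∀ i x → (∀ j → x ≢ c j) → ¬ c i ~ x) → Fin k → ∀ x → ∃ λ j → x ≡ c j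
  exhaustive connected c closed start x = reach (start , refl) (proj₂ (connected (c start) x))
    where
    stays : ∀ i y → c i ~ y → ∃ λ j → y ≡ c j
    stays i y ci~y with any? (λ j → y ≟ c j)
    ... | yes found  = found
    ... | no missing = ⊥-elim (closed i y (λ j y≡cj → missing (j , y≡cj)) ci~y)

    reach : ∀ {a b l} → (∃ λ j → a ≡ c j) → Walk Γ a b l → ∃ λ j → b ≡ c j
    reach found      nil        = found
    reach (j , refl) (cons e w) = reach (stays j _ e) w

  enumeration-iso : ∀ {k} {H : Fin k → Fin k → Set} (c : Fin k → V) → Injective _≡_ _≡_ c →
                    (onto : ∀ x → ∃ λ j → x ≡ c j) → (∀ i j → c i ~ c j ⇔ H i j) → Iso (Adj Γ) H
  enumeration-iso {k} {H} c c-injective onto c-iso = bijection , preserves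
    where
    index : V → Fin k
    index x = proj₁ (onto x)

    bijection : V ↔ Fin k
    bijection = mk↔ₛ′ index c (λ j → ≡-sym (c-injective (proj₂ (onto (c j)))))
                               (λ x → ≡-sym (proj₂ (onto x)))

    preserves : ∀ x y → x ~ y ⇔ H (index x) (index y)
    preserves x y with onto x | onto y
    ... | i , refl | j , refl = c-iso i j

  module Chorded (h : Hexagon) (chord : Hexagon.corner h 5F ~ Hexagon.corner h 1F) where
    open Hexagon h
    open Labelled _≟_ corner corner-injective using (distinct)

    -- Any other short diagonal would close a 4-cycle with the chord.
    only-chord : ∀ i → corner i ~ corner (next (next i)) → i ≡ 5F
    only-chord 0F e = ⊥-elim (square (distinct (0F ∷ 2F ∷ 1F ∷ 5F ∷ [])) e (side⁻ 1F) (~-sym chord) (side 5F))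
    only-chord 1F e = ⊥-elim (square (distinct (1F ∷ 3F ∷ 4F ∷ 5F ∷ [])) e (side 3F) (side 4F) chord)
    only-chord 2F e = ⊥-elim (square (distinct (2F ∷ 4F ∷ 5F ∷ 1F ∷ [])) e (side 4F) chord (side 1F))
    only-chord 3F e = ⊥-elim (square (distinct (3F ∷ 5F ∷ 1F ∷ 2F ∷ [])) e chord (side 1F) (side 2F))
    only-chord 4F e = ⊥-elim (square (distinct (4F ∷ 0F ∷ 1F ∷ 5F ∷ [])) e (side 0F) (~-sym chord) (side⁻ 4F))
    only-chord 5F _ = refl

    short₂ : ∀ i → i ≢ 5F → corner i ~₂ corner (next (next i))
    short₂ i i≢5 = diagonal₂ h i (λ e → i≢5 (only-chord i e))

    -- C5|C3 is the hexagon a b c d e f with the chord bf.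
    hexagon-edge : ∀ i → C53Edge i (next i)
    hexagon-edge 0F = ab
    hexagon-edge 1F = bc
    hexagon-edge 2F = cd
    hexagon-edge 3F = de
    hexagon-edge 4F = ef
    hexagon-edge 5F = fa

    C53Edge⇒adjacent : ∀ {i j} → C53Edge i j → corner i ~ corner j
    C53Edge⇒adjacent ab = side 0F
    C53Edge⇒adjacent bc = side 1F
    C53Edge⇒adjacent cd = side 2F
    C53Edge⇒adjacent de = side 3F
    C53Edge⇒adjacent ef = side 4F
    C53Edge⇒adjacent fa = side 5F
    C53Edge⇒adjacent bf = ~-sym chord

    C5|C3⇒adjacent : ∀ i j → C5|C3 i j → corner i ~ corner j
    C5|C3⇒adjacent _ _ (inj₁ e) = C53Edge⇒adjacent e
    C5|C3⇒adjacent _ _ (inj₂ e) = ~-sym (C53Edge⇒adjacent e)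

    short-chord : ∀ i → corner i ~ corner (next (next i)) → C5|C3 i (next (next i))
    short-chord i e with only-chord i e
    ... | refl = inj₂ bf

    adjacent⇒C5|C3 : ∀ i j → corner i ~ corner j → C5|C3 i j
    adjacent⇒C5|C3 i j e with offset i j
    ... | same _      = ⊥-elim (irrefl Γ e)
    ... | step k      = inj₁ (hexagon-edge k)
    ... | back k      = inj₂ (hexagon-edge k)
    ... | skip k      = short-chord k e
    ... | skip-back k = swap (short-chord k (~-sym e))
    ... | opposite k  = ⊥-elim (opposite-free h k e)

    module _ (x : V) (outside : ∀ j → x ≢ corner j) where
      open WithOutsider h x outside using () renaming (distinct to distinct⁺; apart to apart⁺)

      -- Corners 1 and 5 already have three neighbours.
      untouched₁ : ¬ corner 1F ~ x
      untouched₁ e = subcubic (distinct⁺ (⟨ 0F ⟩ ∷ ⟨ 2F ⟩ ∷ ⟨ 5F ⟩ ∷ ∗ ∷ []))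
                              (side⁻ 0F) (side 1F) (~-sym chord) e

      untouched₅ : ¬ corner 5F ~ x
      untouched₅ e = subcubic (distinct⁺ (⟨ 4F ⟩ ∷ ⟨ 0F ⟩ ∷ ⟨ 1F ⟩ ∷ ∗ ∷ []))
                              (side⁻ 4F) (side 5F) chord e

      -- x c₁ c₃ c₅ would be a 4-cycle of Γ₂.
      untouched₀ : ¬ corner 0F ~ x
      untouched₀ e = square₂ (distinct⁺ (∗ ∷ ⟨ 1F ⟩ ∷ ⟨ 3F ⟩ ∷ ⟨ 5F ⟩ ∷ []))
        (dist2 (apart⁺ ∗ ⟨ 1F ⟩) (≁-sym untouched₁) (~-sym e) (side 0F))
        (short₂ 1F λ ()) (short₂ 3F λ ())
        (dist2 (apart⁺ ⟨ 5F ⟩ ∗) untouched₅ (side 5F) e)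

      -- If also c₃ ~ x, then c₄ has the four Γ₂-neighbours c₀, c₂, c₁, x;
      -- otherwise c₅ is Γ₂-adjacent to c₂ and c₃, on the Γ₂-triangles c₂c₀c₄ and c₃c₁x.
      untouched₂ : ¬ corner 2F ~ x
      untouched₂ e with dec Γ (corner 3F) x
      ... | yes e₃ = subcubic₂ (distinct⁺ (⟨ 0F ⟩ ∷ ⟨ 2F ⟩ ∷ ⟨ 1F ⟩ ∷ ∗ ∷ []))
        (short₂ 4F λ ()) (~₂-sym (short₂ 2F λ ()))
        (dist2 (apart⁺ ⟨ 4F ⟩ ⟨ 1F ⟩) (≁-sym (opposite-free h 1F)) (side 4F) chord)
        (dist2 (apart⁺ ⟨ 4F ⟩ ∗)
               (λ e₄ → square (distinct⁺ (⟨ 4F ⟩ ∷ ∗ ∷ ⟨ 2F ⟩ ∷ ⟨ 3F ⟩ ∷ [])) e₄ (~-sym e) (side 2F) (side 3F))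
               (side⁻ 3F) e₃)
      ... | no ¬e₃ = two-triangles₂ (distinct⁺ (⟨ 5F ⟩ ∷ ⟨ 0F ⟩ ∷ ⟨ 4F ⟩ ∷ ⟨ 1F ⟩ ∷ ∗ ∷ []))
        (dist2 (apart⁺ ⟨ 5F ⟩ ⟨ 2F ⟩) (≁-sym (opposite-free h 2F)) chord (side 1F))
        (~₂-sym (short₂ 3F λ ()))
        (~₂-sym (short₂ 0F λ ())) (short₂ 2F λ ()) (~₂-sym (short₂ 4F λ ()))
        (~₂-sym (short₂ 1F λ ()))
        (dist2 (apart⁺ ⟨ 3F ⟩ ∗) ¬e₃ (side⁻ 2F) e)
        (dist2 (apart⁺ ⟨ 1F ⟩ ∗) untouched₁ (side 1F) e)

      -- The mirror image of untouched₂.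
      untouched₄ : ¬ corner 4F ~ x
      untouched₄ e with dec Γ (corner 3F) x
      ... | yes e₃ = subcubic₂ (distinct⁺ (⟨ 0F ⟩ ∷ ⟨ 4F ⟩ ∷ ⟨ 5F ⟩ ∷ ∗ ∷ []))
        (~₂-sym (short₂ 0F λ ())) (short₂ 2F λ ())
        (dist2 (apart⁺ ⟨ 2F ⟩ ⟨ 5F ⟩) (opposite-free h 2F) (side⁻ 1F) (~-sym chord))
        (dist2 (apart⁺ ⟨ 2F ⟩ ∗)
               (λ e₂ → square (distinct⁺ (⟨ 2F ⟩ ∷ ∗ ∷ ⟨ 4F ⟩ ∷ ⟨ 3F ⟩ ∷ [])) e₂ (~-sym e) (side⁻ 3F) (side⁻ 2F))
               (side 2F) e₃)
      ... | no ¬e₃ = two-triangles₂ (distinct⁺ (⟨ 1F ⟩ ∷ ⟨ 0F ⟩ ∷ ⟨ 2F ⟩ ∷ ⟨ 5F ⟩ ∷ ∗ ∷ []))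
        (dist2 (apart⁺ ⟨ 1F ⟩ ⟨ 4F ⟩) (opposite-free h 1F) (~-sym chord) (side⁻ 4F))
        (short₂ 1F λ ())
        (short₂ 4F λ ()) (~₂-sym (short₂ 2F λ ())) (short₂ 0F λ ())
        (short₂ 3F λ ())
        (dist2 (apart⁺ ⟨ 3F ⟩ ∗) ¬e₃ (side 3F) e)
        (dist2 (apart⁺ ⟨ 5F ⟩ ∗) untouched₅ (side⁻ 4F) e)

      -- x c₂ c₀ c₄ would be a 4-cycle of Γ₂.
      untouched₃ : ¬ corner 3F ~ x
      untouched₃ e = square₂ (distinct⁺ (∗ ∷ ⟨ 2F ⟩ ∷ ⟨ 0F ⟩ ∷ ⟨ 4F ⟩ ∷ []))
        (dist2 (apart⁺ ∗ ⟨ 2F ⟩) (≁-sym untouched₂) (~-sym e) (side⁻ 2F))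
        (~₂-sym (short₂ 0F λ ())) (~₂-sym (short₂ 4F λ ()))
        (dist2 (apart⁺ ⟨ 4F ⟩ ∗) untouched₄ (side⁻ 3F) e)

      untouched : ∀ i → ¬ corner i ~ x
      untouched 0F = untouched₀
      untouched 1F = untouched₁
      untouched 2F = untouched₂
      untouched 3F = untouched₃
      untouched 4F = untouched₄
      untouched 5F = untouched₅

    is-C5|C3 : Connected Γ → Iso (Adj Γ) C5|C3
    is-C5|C3 connected =
      enumeration-iso corner corner-injective
        (exhaustive connected corner (λ i x outside → untouched x outside i) 0F)
        (λ i j → mk⇔ (adjacent⇒C5|C3 i j) (C5|C3⇒adjacent i j))

  Chordless : Hexagon → Set
  Chordless h = ∀ i → ¬ corner i ~ corner (next (next i)) where open Hexagon h

  turn-chordless : ∀ k h → Chordless h → Chordless (turn k h)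
  turn-chordless zero    h chordless = chordless
  turn-chordless (suc k) h chordless = λ i → turn-chordless k h chordless (next i)

  module ChordlessCase (h : Hexagon) (chordless : Chordless h) where
    open Hexagon h

    diagonal : ∀ i → corner i ~₂ corner (next (next i))
    diagonal i = diagonal₂ h i (chordless i)

    -- Adjacent corners are consecutive, so they differ in parity.
    adjacent⇒parity : ∀ i j → corner i ~ corner j → parity i ≢ parity j
    adjacent⇒parity i j e with offset i j
    ... | same _      = ⊥-elim (irrefl Γ e)
    ... | step k      = parity-alternates k
    ... | back k      = ≢-sym (parity-alternates k)
    ... | skip k      = ⊥-elim (chordless k e)
    ... | skip-back k = ⊥-elim (chordless k (~-sym e))
    ... | opposite k  = ⊥-elim (opposite-free h k e)

    module _ (x : V) (outside : ∀ j → x ≢ corner j) where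
      open WithOutsider h x outside using () renaming (distinct to distinct⁺; apart to apart⁺)

      -- If x ~ c₀, c₁, then x is Γ₂-adjacent to c₂ and c₅, which lie on the
      -- Γ₂-triangles c₂c₀c₄ and c₅c₁c₃.
      not-both : corner 0F ~ x → corner 1F ~ x → ⊥
      not-both e₀ e₁ = two-triangles₂ (distinct⁺ (∗ ∷ ⟨ 0F ⟩ ∷ ⟨ 4F ⟩ ∷ ⟨ 1F ⟩ ∷ ⟨ 3F ⟩ ∷ []))
        (dist2 (apart⁺ ∗ ⟨ 2F ⟩)
               (λ e₂ → square (distinct⁺ (∗ ∷ ⟨ 0F ⟩ ∷ ⟨ 1F ⟩ ∷ ⟨ 2F ⟩ ∷ [])) (~-sym e₀) (side 0F) (side 1F) (~-sym e₂))
               (~-sym e₁) (side 1F))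
        (dist2 (apart⁺ ∗ ⟨ 5F ⟩)
               (λ e₅ → square (distinct⁺ (∗ ∷ ⟨ 1F ⟩ ∷ ⟨ 0F ⟩ ∷ ⟨ 5F ⟩ ∷ [])) (~-sym e₁) (side⁻ 0F) (side⁻ 5F) (~-sym e₅))
               (~-sym e₀) (side⁻ 5F))
        (~₂-sym (diagonal 0F)) (diagonal 2F) (~₂-sym (diagonal 4F))
        (diagonal 5F) (~₂-sym (diagonal 3F)) (diagonal 1F)

      -- If x ~ c₀ but neither c₁ ~ x nor c₅ ~ x, then x c₁ c₃ c₅ is a 4-cycle of Γ₂.
      untouched₀ : ¬ (corner 5F ~ x × corner 0F ~ x) → ¬ corner 0F ~ x
      untouched₀ not-both′ e = square₂ (distinct⁺ (∗ ∷ ⟨ 1F ⟩ ∷ ⟨ 3F ⟩ ∷ ⟨ 5F ⟩ ∷ []))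
        (dist2 (apart⁺ ∗ ⟨ 1F ⟩) (λ e₁ → not-both e (~-sym e₁)) (~-sym e) (side 0F))
        (diagonal 1F) (diagonal 3F)
        (dist2 (apart⁺ ⟨ 5F ⟩ ∗) (λ e₅ → not-both′ (e₅ , e)) (side 5F) e)

  -- No outside vertex is adjacent to c₀: not-both is used for the side c₀c₁
  -- and, in the hexagon turned five times, for the side c₅c₀.
  chordless-untouched₀ : ∀ h → Chordless h → ∀ x → (∀ j → x ≢ Hexagon.corner h j) →
                         ¬ Hexagon.corner h 0F ~ x
  chordless-untouched₀ h chordless x outside =
    ChordlessCase.untouched₀ h chordless x outside
      (λ (e₅ , e₀) → ChordlessCase.not-both (turn 5 h) (turn-chordless 5 h chordless) x (λ j → outside _) e₅ e₀)

  chordless-untouched : ∀ h → Chordless h → ∀ x → (∀ j → x ≢ Hexagon.corner h j) →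
                        ∀ i → ¬ Hexagon.corner h i ~ x
  chordless-untouched h c x outside 0F = chordless-untouched₀ h c x outside
  chordless-untouched h c x outside 1F = chordless-untouched₀ (turn 1 h) (turn-chordless 1 h c) x (λ j → outside _)
  chordless-untouched h c x outside 2F = chordless-untouched₀ (turn 2 h) (turn-chordless 2 h c) x (λ j → outside _)
  chordless-untouched h c x outside 3F = chordless-untouched₀ (turn 3 h) (turn-chordless 3 h c) x (λ j → outside _)
  chordless-untouched h c x outside 4F = chordless-untouched₀ (turn 4 h) (turn-chordless 4 h c) x (λ j → outside _)
  chordless-untouched h c x outside 5F = chordless-untouched₀ (turn 5 h) (turn-chordless 5 h c) x (λ j → outside _)

  -- So Γ would be the bipartite hexagon, yet φ maps the Γ₂-triangle c₀c₂c₄ to a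
  -- triangle of Γ.
  chordless-impossible : Connected Γ → ∀ h → ¬ Chordless h
  chordless-impossible connected h chordless =
    triangle (onto (φ (corner 0F))) (onto (φ (corner 2F))) (onto (φ (corner 4F)))
    where
    open Hexagon h
    open ChordlessCase h chordless

    onto : ∀ x → ∃ λ j → x ≡ corner j
    onto = exhaustive connected corner (λ i x outside → chordless-untouched h chordless x outside i) 0F

    triangle : (∃ λ i → φ (corner 0F) ≡ corner i) → (∃ λ j → φ (corner 2F) ≡ corner j) →
               (∃ λ k → φ (corner 4F) ≡ corner k) → ⊥
    triangle (i , p) (j , q) (k , r) =
      three-bools (parity i) (parity j) (parity k)
        (adjacent⇒parity i j (subst₂ _~_ p q (φ-hom (diagonal 0F))))
        (adjacent⇒parity j k (subst₂ _~_ q r (φ-hom (diagonal 2F))))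
        (adjacent⇒parity k i (subst₂ _~_ r p (φ-hom (diagonal 4F))))

  chord-to-front : ∀ h i → Hexagon.corner h i ~ Hexagon.corner h (next (next i)) →
                   Σ Hexagon λ g → Hexagon.corner g 5F ~ Hexagon.corner g 1F
  chord-to-front h 0F chord = turn 1 h , chord
  chord-to-front h 1F chord = turn 2 h , chord
  chord-to-front h 2F chord = turn 3 h , chord
  chord-to-front h 3F chord = turn 4 h , chord
  chord-to-front h 4F chord = turn 5 h , chord
  chord-to-front h 5F chord = h , chord

  hexagon⇒C5|C3 : Connected Γ → SubgraphOf C₆ (Adj Γ) → Iso (Adj Γ) C5|C3
  hexagon⇒C5|C3 connected C₆⊆Γ = cases (any? λ i → dec Γ (corner i) (corner (next (next i))))
    where
    h : Hexagon
    h = hexagon C₆⊆Γ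
    open Hexagon h

    cases : Dec (∃ λ i → corner i ~ corner (next (next i))) → Iso (Adj Γ) C5|C3
    cases (yes (i , chord)) = let (g , chord′) = chord-to-front h i chord in Chorded.is-C5|C3 g chord′ connected
    cases (no no-chord)     = ⊥-elim (chordless-impossible connected h (λ i chord → no-chord (i , chord)))

-- Lemma 3.4.
lemma3p4 : (Γ : Graph) → Connected Γ → 2 ≤ n Γ →
    Iso (Adj₂ Γ) (Adj Γ) →
    ¬ SubgraphOf C₄ (Adj Γ) →
    ¬ IsOddCycle Γ →
    SubgraphOf C₆ (Adj Γ) →
    Iso (Adj Γ) C5|C3
lemma3p4 Γ connected _ Γ₂≅Γ C₄-free _ =
  Setting.hexagon⇒C5|C3 Γ C₄-free Γ₂≅Γ connected
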